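{- Let $\eta\in\mathbb{N}^n$ be a nonzero composition with critical box $s[\eta]=(k,m)$. (1) If $k>1$ then $s[\Phi\eta]=(k-1,m)$; if $k=1$ then $s[\Phi\eta]=(n,m+1)$. (2) For $1\le i\le n-1$, if $s_i\eta\ne\eta$ then $s[s_i\eta]=(s_i(k),m)$.
   Context: For a nonzero composition $\eta\in\mathbb{N}^n$, its critical box is $s[\eta]=(k,m)$ where $m=\max_i\eta_i$ and $k=\min\{i:\eta_i=m\}$. $\Phi\eta=(\eta_2,\dots,\eta_n,\eta_1+1)$; $s_i\eta$ is $\eta$ with entries $\eta_i,\eta_{i+1}$ swapped; $s_i(k)$ denotes the image of the index $k$ under the transposition $(i\ i{+}1)$. -}

module Defs where

open import Data.Nat using (ℕ; zero; suc; _⊔_; _<_)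
open import Data.Fin using (Fin; zero; suc; inject₁; fromℕ; toℕ)
open import Data.Vec using (Vec; []; _∷_; lookup; _∷ʳ_; _[_]≔_)
open import Data.Product using (_×_; ∃)
open import Relation.Binary.PropositionalEquality using (_≡_; _≢_)

-- Compositions in ℕ^n are vectors; index i ∈ Fin n stands for position i+1.

maxEntry : ∀ {n} → Vec ℕ n → ℕ
maxEntry [] = 0
maxEntry (x ∷ xs) = x ⊔ maxEntry xs

NonZeroComp : ∀ {n} → Vec ℕ n → Set
NonZeroComp {n} η = ∃ λ (i : Fin n) → lookup η i ≢ 0

CritBox : ∀ {n} → Vec ℕ n → Fin n → ℕ → Set
CritBox η k m =
  (m ≡ maxEntry η) × (lookup η k ≡ m) × (∀ j → toℕ j < toℕ k → lookup η j ≢ m)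

Φ : ∀ {n} → Vec ℕ (suc n) → Vec ℕ (suc n)
Φ (x ∷ xs) = xs ∷ʳ suc x

-- the transposition (i i+1) on indices, for i ∈ {1..n-1} given as Fin n
-- (acting on Fin (suc n)): inject₁ i ↔ suc i
swapIx : ∀ {n} → Fin n → Fin (suc n) → Fin (suc n)
swapIx zero zero = suc zero
swapIx zero (suc zero) = zero
swapIx zero (suc (suc j)) = suc (suc j)
swapIx (suc i) zero = zero
swapIx (suc i) (suc j) = suc (swapIx i j)

sᵢ : ∀ {n} → Fin n → Vec ℕ (suc n) → Vec ℕ (suc n)
sᵢ i η = (η [ inject₁ i ]≔ lookup η (suc i)) [ suc i ]≔ lookup η (inject₁ i)

-- (k, m) is the critical box of η exactly when every entry is ≤ m, η_k = m, and
-- no earlier entry equals m.  Φ and s_i only permute the entries (Φ also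
-- increments one), so these conditions transfer along the permutation.  Order
-- of indices is preserved except at the wrap-around of Φ, harmless because
-- η_1 < m when k > 1, and at the pair (i, i+1) of s_i, harmless because
-- η_i ≠ η_{i+1} when s_i η ≠ η.
module Submission where

open import Defs
open import Data.Nat using (ℕ; suc; _≤_; _<_; z≤n; s≤s; z<s; s<s)
open import Data.Nat.Properties
  using (m≤m⊔n; m≤n⊔m; ⊔-lub; ≤-trans; ≤-antisym; ≤∧≢⇒<; <-irrefl; <⇒≱; <⇒≢; n≤1+n)
open import Data.Fin using (Fin; zero; suc; fromℕ; inject₁; toℕ)
open import Data.Fin.Properties using (toℕ-inject₁; ≤fromℕ)
open import Data.Fin.Relation.Unary.Top using (view; ‵fromℕ; ‵inject₁)
open import Data.Vec using (Vec; []; _∷_; lookup; _∷ʳ_; _[_]≔_)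
open import Data.Vec.Properties using ([]≔-lookup)
open import Data.Product using (_×_; _,_)
open import Data.Sum as Sum using (_⊎_; inj₁; inj₂)
open import Data.Empty using (⊥-elim)
open import Relation.Binary.PropositionalEquality
  using (_≡_; _≢_; refl; sym; trans; cong; subst; subst₂; module ≡-Reasoning)

lookup≤maxEntry : ∀ {n} (v : Vec ℕ n) j → lookup v j ≤ maxEntry v
lookup≤maxEntry (x ∷ v) zero    = m≤m⊔n x (maxEntry v)
lookup≤maxEntry (x ∷ v) (suc j) = ≤-trans (lookup≤maxEntry v j) (m≤n⊔m x (maxEntry v))

maxEntry≤ : ∀ {n} (v : Vec ℕ n) {m} → (∀ j → lookup v j ≤ m) → maxEntry v ≤ m
maxEntry≤ []      _     = z≤n
maxEntry≤ (x ∷ v) bound = ⊔-lub (bound zero) (maxEntry≤ v (λ j → bound (suc j)))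

critBox-intro : ∀ {n} (v : Vec ℕ n) k {m} →
  (∀ j → lookup v j ≤ m) → lookup v k ≡ m →
  (∀ j → toℕ j < toℕ k → lookup v j ≢ m) → CritBox v k m
critBox-intro v k bound vk≡m earliest =
  ≤-antisym (subst (_≤ maxEntry v) vk≡m (lookup≤maxEntry v k)) (maxEntry≤ v bound)
  , vk≡m , earliest

critBox⇒lookup≤ : ∀ {n} {v : Vec ℕ n} {k m} → CritBox v k m → ∀ j → lookup v j ≤ m
critBox⇒lookup≤ {v = v} (m≡max , _ , _) j = subst (lookup v j ≤_) (sym m≡max) (lookup≤maxEntry v j)

module _ {a} {A : Set a} where

  lookup-∷ʳ-fromℕ : ∀ {n} (xs : Vec A n) y → lookup (xs ∷ʳ y) (fromℕ n) ≡ y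
  lookup-∷ʳ-fromℕ []       y = refl
  lookup-∷ʳ-fromℕ (x ∷ xs) y = lookup-∷ʳ-fromℕ xs y

  lookup-∷ʳ-inject₁ : ∀ {n} (xs : Vec A n) y j → lookup (xs ∷ʳ y) (inject₁ j) ≡ lookup xs j
  lookup-∷ʳ-inject₁ (x ∷ xs) y zero    = refl
  lookup-∷ʳ-inject₁ (x ∷ xs) y (suc j) = lookup-∷ʳ-inject₁ xs y j

toℕ-inject₁-< : ∀ {n} {i j : Fin n} → toℕ (inject₁ i) < toℕ (inject₁ j) → toℕ i < toℕ j
toℕ-inject₁-< {i = i} {j} = subst₂ _<_ (toℕ-inject₁ i) (toℕ-inject₁ j)

Φ-critBox-suc : ∀ {n} (η : Vec ℕ (suc n)) (k : Fin n) m →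
  CritBox η (suc k) m → CritBox (Φ η) (inject₁ k) m
Φ-critBox-suc (x ∷ xs) k m cb@(_ , ηk≡m , earliest) =
  critBox-intro (Φ (x ∷ xs)) (inject₁ k) bound (trans (lookup-∷ʳ-inject₁ xs (suc x) k) ηk≡m) before
  where
  x<m : x < m
  x<m = ≤∧≢⇒< (critBox⇒lookup≤ cb zero) (earliest zero z<s)

  bound : ∀ j → lookup (xs ∷ʳ suc x) j ≤ m
  bound j with view j
  ... | ‵fromℕ      rewrite lookup-∷ʳ-fromℕ xs (suc x)     = x<m
  ... | ‵inject₁ j′ rewrite lookup-∷ʳ-inject₁ xs (suc x) j′ = critBox⇒lookup≤ cb (suc j′)

  before : ∀ j → toℕ j < toℕ (inject₁ k) → lookup (xs ∷ʳ suc x) j ≢ m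
  before j j<k with view j
  ... | ‵fromℕ      = ⊥-elim (<⇒≱ j<k (≤fromℕ (inject₁ k)))
  ... | ‵inject₁ j′ rewrite lookup-∷ʳ-inject₁ xs (suc x) j′ =
    earliest (suc j′) (s<s (toℕ-inject₁-< j<k))

Φ-critBox-zero : ∀ {n} (η : Vec ℕ (suc n)) m →
  CritBox η zero m → CritBox (Φ η) (fromℕ n) (suc m)
Φ-critBox-zero (x ∷ xs) m cb@(_ , x≡m , _) =
  critBox-intro (Φ (x ∷ xs)) (fromℕ _) bound (trans (lookup-∷ʳ-fromℕ xs (suc x)) (cong suc x≡m)) before
  where
  bound : ∀ j → lookup (xs ∷ʳ suc x) j ≤ suc m
  bound j with view j
  ... | ‵fromℕ      rewrite lookup-∷ʳ-fromℕ xs (suc x)     = s≤s (critBox⇒lookup≤ cb zero)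
  ... | ‵inject₁ j′ rewrite lookup-∷ʳ-inject₁ xs (suc x) j′ =
    ≤-trans (critBox⇒lookup≤ cb (suc j′)) (n≤1+n m)

  before : ∀ j → toℕ j < toℕ (fromℕ _) → lookup (xs ∷ʳ suc x) j ≢ suc m
  before j j<k with view j
  ... | ‵fromℕ      = ⊥-elim (<-irrefl refl j<k)
  ... | ‵inject₁ j′ rewrite lookup-∷ʳ-inject₁ xs (suc x) j′ =
    <⇒≢ (s≤s (critBox⇒lookup≤ cb (suc j′)))

lookup-sᵢ : ∀ {n} (i : Fin n) (η : Vec ℕ (suc n)) j → lookup (sᵢ i η) j ≡ lookup η (swapIx i j)
lookup-sᵢ zero    (a ∷ b ∷ η) zero          = refl
lookup-sᵢ zero    (a ∷ b ∷ η) (suc zero)    = refl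
lookup-sᵢ zero    (a ∷ b ∷ η) (suc (suc j)) = refl
lookup-sᵢ (suc i) (a ∷ η)     zero          = refl
lookup-sᵢ (suc i) (a ∷ η)     (suc j)       = lookup-sᵢ i η j

swapIx-involutive : ∀ {n} (i : Fin n) j → swapIx i (swapIx i j) ≡ j
swapIx-involutive zero    zero          = refl
swapIx-involutive zero    (suc zero)    = refl
swapIx-involutive zero    (suc (suc j)) = refl
swapIx-involutive (suc i) zero          = refl
swapIx-involutive (suc i) (suc j)       = cong suc (swapIx-involutive i j)

swapIx-inject₁ : ∀ {n} (i : Fin n) → swapIx i (inject₁ i) ≡ suc i
swapIx-inject₁ zero    = refl
swapIx-inject₁ (suc i) = cong suc (swapIx-inject₁ i)

swapIx-reflects-< : ∀ {n} (i : Fin n) j k → toℕ j < toℕ (swapIx i k) →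
  toℕ (swapIx i j) < toℕ k ⊎ (j ≡ inject₁ i × k ≡ inject₁ i)
swapIx-reflects-< zero    zero          zero          _          = inj₂ (refl , refl)
swapIx-reflects-< zero    (suc _)       zero          (s<s ())
swapIx-reflects-< zero    zero          (suc (suc k)) _          = inj₁ (s<s z<s)
swapIx-reflects-< zero    (suc zero)    (suc (suc k)) _          = inj₁ z<s
swapIx-reflects-< zero    (suc (suc j)) (suc (suc k)) j<k        = inj₁ j<k
swapIx-reflects-< (suc i) zero          (suc k)       _          = inj₁ z<s
swapIx-reflects-< (suc i) (suc j)       (suc k)       (s<s j<k)  =
  Sum.map s<s (λ { (refl , refl) → refl , refl }) (swapIx-reflects-< i j k j<k)

sᵢ-fixes-equal : ∀ {n} (i : Fin n) (η : Vec ℕ (suc n)) →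
  lookup η (inject₁ i) ≡ lookup η (suc i) → sᵢ i η ≡ η
sᵢ-fixes-equal i η ηi≡ηi+1 = begin
  (η [ inject₁ i ]≔ lookup η (suc i)) [ suc i ]≔ lookup η (inject₁ i)
    ≡⟨ cong (λ a → (η [ inject₁ i ]≔ a) [ suc i ]≔ lookup η (inject₁ i)) (sym ηi≡ηi+1) ⟩
  (η [ inject₁ i ]≔ lookup η (inject₁ i)) [ suc i ]≔ lookup η (inject₁ i)
    ≡⟨ cong (_[ suc i ]≔ lookup η (inject₁ i)) ([]≔-lookup η (inject₁ i)) ⟩
  η [ suc i ]≔ lookup η (inject₁ i)
    ≡⟨ cong (η [ suc i ]≔_) ηi≡ηi+1 ⟩
  η [ suc i ]≔ lookup η (suc i)
    ≡⟨ []≔-lookup η (suc i) ⟩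
  η ∎
  where open ≡-Reasoning

sᵢ-critBox : ∀ {n} (η : Vec ℕ (suc n)) k m → CritBox η k m →
  ∀ (i : Fin n) → sᵢ i η ≢ η → CritBox (sᵢ i η) (swapIx i k) m
sᵢ-critBox η k m cb@(_ , ηk≡m , earliest) i sᵢη≢η =
  critBox-intro (sᵢ i η) (swapIx i k) bound attained before
  where
  η≤m : ∀ j → lookup η j ≤ m
  η≤m = critBox⇒lookup≤ {v = η} {k} cb

  bound : ∀ j → lookup (sᵢ i η) j ≤ m
  bound j = subst (_≤ m) (sym (lookup-sᵢ i η j)) (η≤m (swapIx i j))

  attained : lookup (sᵢ i η) (swapIx i k) ≡ m
  attained = trans (lookup-sᵢ i η _) (trans (cong (lookup η) (swapIx-involutive i k)) ηk≡m)

  before : ∀ j → toℕ j < toℕ (swapIx i k) → lookup (sᵢ i η) j ≢ m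
  before j j<σk sᵢηj≡m with swapIx-reflects-< i j k j<σk
  ... | inj₁ σj<k = earliest (swapIx i j) σj<k (trans (sym (lookup-sᵢ i η j)) sᵢηj≡m)
  ... | inj₂ (j≡i , k≡i) = sᵢη≢η (sᵢ-fixes-equal i η (begin
    lookup η (inject₁ i)            ≡⟨ cong (lookup η) (sym k≡i) ⟩
    lookup η k                      ≡⟨ ηk≡m ⟩
    m                               ≡⟨ sym sᵢηj≡m ⟩
    lookup (sᵢ i η) j               ≡⟨ lookup-sᵢ i η j ⟩
    lookup η (swapIx i j)           ≡⟨ cong (λ j → lookup η (swapIx i j)) j≡i ⟩
    lookup η (swapIx i (inject₁ i)) ≡⟨ cong (lookup η) (swapIx-inject₁ i) ⟩
    lookup η (suc i)                ∎))
    where open ≡-Reasoning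

proposition4p2 : ∀ {n} (η : Vec ℕ (suc n)) (k : Fin (suc n)) (m : ℕ) →
    NonZeroComp η → CritBox η k m →
    ((∀ (k′ : Fin n) → k ≡ suc k′ → CritBox (Φ η) (inject₁ k′) m)
      × (k ≡ zero → CritBox (Φ η) (fromℕ n) (suc m)))
    × (∀ (i : Fin n) → sᵢ i η ≢ η → CritBox (sᵢ i η) (swapIx i k) m)
proposition4p2 η k m _ cb =
  ( (λ { k′ refl → Φ-critBox-suc η k′ m cb })
  , (λ { refl → Φ-critBox-zero η m cb }) )
  , sᵢ-critBox η k m cb
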